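{- Let $\lambda_+/\lambda_-$ be a diagonal of $R$, let $\sigma=\sigma_1\sigma_2\dots$ be an infinite sequence with terms in $\{1,\dots,n\}$, let $U\in\mathrm{SYT}(\lambda_-)$, and write $\mathcal{B}^U_\sigma=x_1x_2x_3\dots$. For every $k$: if $\sigma_k<\sigma_{k+1}$ then $x_k<x_{k+1}$, and if $\sigma_k>\sigma_{k+1}$ then $x_k>x_{k+1}$.
   Context: Fix integers $m\ge n\ge 1$. English convention (row $1$ on top); "above" = smaller row index, "right" = larger column index. $R$ is a rectangular Young diagram with $n$ rows and $m$ columns or $m$ rows and $n$ columns. A diagonal of $R$ is a skew shape $\lambda_+/\lambda_-$ ($\lambda_-\subseteq\lambda_+\subseteq R$ Young diagrams) consisting of exactly $n$ boxes $b_1,\dots,b_n$, $b_{i+1}$ strictly above and strictly right of $b_i$. Reverse-sliding an empty box $x$ through a filling $T$ (strictly increasing along rows and columns): while the empty box has a filled neighbour immediately to its left or immediately above it, move the larger such entry into the empty box; the box where it ends is the final position of the sliding path. Box sequences: for $\sigma$ and $U\in\mathrm{SYT}(\lambda_-)$, set $U_0=U$ and for $k=1,2,\dots$: let $U_k$ be obtained by reverse-sliding the (empty) box $b_{\sigma_k}$ through $U_{k-1}$, let $x_k$ be the final position of the sliding path, then delete from $U_k$ the entry in $b_{\sigma_k}$ if there is one. $\mathcal{B}^U_\sigma=x_1x_2x_3\dots$. Partial order on boxes of $\lambda_+$: $x\le x'$ iff $x'$ is weakly to the right of and weakly above $x$; $x<x'$ means $x\le x'$ and $x\ne x'$. -}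

module Defs where

open import Data.Nat using (ℕ; zero; suc; _+_; _≤_; _<_; _<?_)
open import Data.Nat.Properties using (_≟_)
open import Data.Fin using (Fin; toℕ) renaming (suc to fsuc; zero to fzero)
open import Data.Maybe using (Maybe; just; nothing)
open import Data.Product using (_×_; _,_; proj₁; proj₂; ∃; ∃-syntax; Σ)
open import Data.Sum using (_⊎_)
open import Data.Bool using (if_then_else_)
open import Relation.Nullary using (¬_; yes; no)
open import Relation.Nullary.Decidable using (⌊_⌋; _×-dec_)
open import Relation.Binary.PropositionalEquality using (_≡_; _≢_)
open import Function.Bundles using (_⇔_)

-- Boxes.  A box is (row , column), 0-based, English convention:
-- row 0 is the top row, column 0 the leftmost column.

Box : Set
Box = ℕ × ℕ

row col : Box → ℕ
row = proj₁
col = proj₂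

record YoungDiagram : Set where
  field
    rowLen   : ℕ → ℕ
    weaklyDecreasing : ∀ r → rowLen (suc r) ≤ rowLen r
    finiteSupport    : ∃[ N ] (∀ r → N ≤ r → rowLen r ≡ 0)
open YoungDiagram public

_∈ʸ_ : Box → YoungDiagram → Set
x ∈ʸ λ′ = col x < rowLen λ′ (row x)

_⊆ʸ_ : YoungDiagram → YoungDiagram → Set
μ ⊆ʸ λ′ = ∀ x → x ∈ʸ μ → x ∈ʸ λ′

InRect : ℕ → ℕ → YoungDiagram → Set
InRect a b λ′ = ∀ x → x ∈ʸ λ′ → (row x < a) × (col x < b)

-- Diagonals.  λ₊/λ₋ is a diagonal (of R, whose shorter side is n) with
-- boxes  b 0 , … , b (n-1)  (= b₁ … bₙ of the paper), b (i+1) strictly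
-- above and strictly right of b i, and these are exactly the boxes of the
-- skew shape λ₊/λ₋.

IsDiagonal : (n : ℕ) → YoungDiagram → YoungDiagram → (Fin n → Box) → Set
IsDiagonal n λ₊ λ₋ b =
    λ₋ ⊆ʸ λ₊
  × (∀ x → ((x ∈ʸ λ₊) × ¬ (x ∈ʸ λ₋)) ⇔ (∃[ i ] b i ≡ x))
  × (∀ (i j : Fin n) → toℕ j ≡ suc (toℕ i) →
        (row (b j) < row (b i)) × (col (b i) < col (b j)))

-- Fillings: a (partial) assignment of positive integers to boxes;
-- nothing = empty box.

Filling : Set
Filling = ℕ → ℕ → Maybe ℕ

IsSYT : YoungDiagram → Filling → Set
IsSYT λ′ U =
    (∀ r c → (r , c) ∈ʸ λ′ → ∃[ v ] U r c ≡ just v)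
  × (∀ r c → ¬ ((r , c) ∈ʸ λ′) → U r c ≡ nothing)
  × (∀ r c r′ c′ v → U r c ≡ just v → U r′ c′ ≡ just v → (r , c) ≡ (r′ , c′))
  × (∃[ N ] ∀ v → (∃[ r ] ∃[ c ] U r c ≡ just v) ⇔ ((1 ≤ v) × (v ≤ N)))
  × (∀ r c a a′ → U r c ≡ just a → U r (suc c) ≡ just a′ → a < a′)
  × (∀ r c a a′ → U r c ≡ just a → U (suc r) c ≡ just a′ → a < a′)

set : ℕ → ℕ → Maybe ℕ → Filling → Filling
set r c v T r′ c′ = if ⌊ (r′ ≟ r) ×-dec (c′ ≟ c) ⌋ then v else T r′ c′

move : ℕ → ℕ → ℕ → ℕ → Filling → Filling
move r c r′ c′ T = set r c nothing (set r′ c′ (T r c) T)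

-- Reverse-slide the empty box (r , c) through T.
-- Implemented with a fuel argument; every move decreases row + col by 1,
-- so fuel  r + c  (used in  revSlide  below) is always sufficient.
slideFuel : ℕ → ℕ → ℕ → Filling → Filling × Box
slideFuel zero r c T = set r c nothing T , (r , c)
slideFuel (suc f) zero zero T = set zero zero nothing T , (zero , zero)
slideFuel (suc f) zero (suc c) T with T zero c
... | nothing = set zero (suc c) nothing T , (zero , suc c)
... | just _  = slideFuel f zero c (move zero c zero (suc c) T)
slideFuel (suc f) (suc r) zero T with T r zero
... | nothing = set (suc r) zero nothing T , (suc r , zero)
... | just _  = slideFuel f r zero (move r zero (suc r) zero T)
slideFuel (suc f) (suc r) (suc c) T with T (suc r) c | T r (suc c)
... | nothing | nothing = set (suc r) (suc c) nothing T , (suc r , suc c)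
... | just _  | nothing = slideFuel f (suc r) c (move (suc r) c (suc r) (suc c) T)
... | nothing | just _  = slideFuel f r (suc c) (move r (suc c) (suc r) (suc c) T)
... | just a  | just a′ with a′ <? a
...   | yes _ = slideFuel f (suc r) c (move (suc r) c (suc r) (suc c) T)
...   | no  _ = slideFuel f r (suc c) (move r (suc c) (suc r) (suc c) T)

revSlide : ℕ → ℕ → Filling → Filling × Box
revSlide r c T = slideFuel (r + c) r c T

stepFilling : Box → Filling → Filling
stepFilling x T = set (row x) (col x) nothing (proj₁ (revSlide (row x) (col x) T))

-- U_k  (k = 0, 1, 2, …), for σ indexed from 0:  σ k = σ_{k+1} of the paper.
states : ∀ {n} → (Fin n → Box) → (ℕ → Fin n) → Filling → ℕ → Filling
states b σ U zero    = U
states b σ U (suc k) = stepFilling (b (σ k)) (states b σ U k)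

-- The box sequence  B^U_σ : the k-th term (0-based) is x_{k+1} of the paper.
boxSeq : ∀ {n} → (Fin n → Box) → (ℕ → Fin n) → Filling → ℕ → Box
boxSeq b σ U k =
  proj₂ (revSlide (row (b (σ k))) (col (b (σ k))) (states b σ U k))

_≤ᵇ_ : Box → Box → Set
x ≤ᵇ x′ = (col x ≤ col x′) × (row x′ ≤ row x)

_<ᵇ_ : Box → Box → Set
x <ᵇ x′ = (x ≤ᵇ x′) × (x ≢ x′)

module Submission where

open import Defs
open import Data.Nat using (ℕ; zero; suc; _+_; _≤_; _<_; z≤n; s≤s; s≤s⁻¹)
open import Data.Nat.Properties
open import Data.Fin using (Fin; toℕ; fromℕ<) renaming (_<_ to _<ᶠ_; _>_ to _>ᶠ_)
open import Data.Fin.Properties using (toℕ-fromℕ<; toℕ-injective; toℕ<n)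
open import Data.Maybe using (Maybe; just; nothing)
open import Data.Maybe.Properties using (just-injective)
open import Data.Product using (_×_; _,_; proj₁; proj₂; Σ-syntax; ∃-syntax)
open import Data.Sum using (_⊎_; inj₁; inj₂)
open import Data.Empty using (⊥; ⊥-elim)
open import Relation.Nullary using (¬_; yes; no)
open import Relation.Nullary.Decidable using (_×-dec_)
open import Relation.Binary.PropositionalEquality
open import Function.Bundles using (_⇔_; Equivalence)
open import Relation.Binary.Definitions using (tri<; tri≈; tri>)

-- A reverse slide of the empty box h through T is described by a Path: the
-- sequence of up/left moves of the empty box, all read off T itself, ending
-- in a box x.
-- The heart of the proof (Consecutive) compares the path P of one slide with
-- the path Q of the next one: if Q starts strictly above-right of the start
-- of P, it stays strictly north-east of P and ends strictly above-right of
-- the end of P; symmetrically for below-left.  Since the diagonal boxes are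
-- ordered along the diagonal and have their upper and left neighbours in λ₋
-- (Diagonal), the proposition follows by applying this to U_k and U_{k+1}.

_≐_ : Filling → Filling → Set
F ≐ G = ∀ r c → F r c ≡ G r c

≐-sym : ∀ {F G} → F ≐ G → G ≐ F
≐-sym e r c = sym (e r c)

≐-trans : ∀ {F G H} → F ≐ G → G ≐ H → F ≐ H
≐-trans e₁ e₂ r c = trans (e₁ r c) (e₂ r c)

Diff : ℕ → ℕ → ℕ → ℕ → Set
Diff r c r′ c′ = ¬ (r′ ≡ r × c′ ≡ c)

Diff? : ∀ r c r′ c′ → (r′ ≡ r × c′ ≡ c) ⊎ Diff r c r′ c′
Diff? r c r′ c′ with (r′ ≟ r) ×-dec (c′ ≟ c)
... | yes p = inj₁ p
... | no ¬p = inj₂ ¬p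

Diff-lower : ∀ {r c r′ c′} → r′ + c′ < r + c → Diff r c r′ c′
Diff-lower lt (refl , refl) = <-irrefl refl lt

Diff-higher : ∀ {r c r′ c′} → r + c < r′ + c′ → Diff r c r′ c′
Diff-higher lt (refl , refl) = <-irrefl refl lt

set-same : ∀ r c v T → set r c v T r c ≡ v
set-same r c v T with (r ≟ r) ×-dec (c ≟ c)
... | yes _ = refl
... | no ¬p = ⊥-elim (¬p (refl , refl))

set-other : ∀ r c v T r′ c′ → Diff r c r′ c′ → set r c v T r′ c′ ≡ T r′ c′
set-other r c v T r′ c′ d with (r′ ≟ r) ×-dec (c′ ≟ c)
... | yes p = ⊥-elim (d p)
... | no _ = refl

set-cong : ∀ r c v {F G} → F ≐ G → set r c v F ≐ set r c v G
set-cong r c v e r′ c′ with (r′ ≟ r) ×-dec (c′ ≟ c)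
... | yes _ = refl
... | no _ = e r′ c′

set-set : ∀ r c v w F → set r c v (set r c w F) ≐ set r c v F
set-set r c v w F r′ c′ with (r′ ≟ r) ×-dec (c′ ≟ c)
... | yes _ = refl
... | no _ = refl

set-comm : ∀ r c v r₁ c₁ w F → Diff r c r₁ c₁ →
  set r c v (set r₁ c₁ w F) ≐ set r₁ c₁ w (set r c v F)
set-comm r c v r₁ c₁ w F d r′ c′ with (r′ ≟ r) ×-dec (c′ ≟ c) | (r′ ≟ r₁) ×-dec (c′ ≟ c₁)
... | yes (refl , refl) | yes (refl , refl) = ⊥-elim (d (refl , refl))
... | yes _ | no _ = refl
... | no _  | yes _ = refl
... | no _  | no _ = refl

r+c<r+1+c : ∀ r c → r + c < r + suc c
r+c<r+1+c r c = ≤-reflexive (sym (+-suc r c))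

lower-below⇒left : ∀ {r c r′ c′} → r′ + c′ < r + c → r < r′ → c′ < c
lower-below⇒left lt₁ lt₂ = ≰⇒> λ c≤c′ → <-asym lt₁ (+-mono-<-≤ lt₂ c≤c′)

lower-right⇒above : ∀ {r c r′ c′} → r′ + c′ < r + c → c < c′ → r′ < r
lower-right⇒above lt₁ lt₂ = ≰⇒> λ r≤r′ → <-asym lt₁ (+-mono-≤-< r≤r′ lt₂)

same-left⇒below : ∀ {r c r′ c′} → r′ + c′ ≡ r + c → c′ < c → r < r′
same-left⇒below e lt = ≰⇒> λ r′≤r → <-irrefl e (+-mono-≤-< r′≤r lt)

same-above⇒right : ∀ {r c r′ c′} → r′ + c′ ≡ r + c → r′ < r → c < c′
same-above⇒right e lt = ≰⇒> λ c′≤c → <-irrefl e (+-mono-<-≤ lt c′≤c)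

<+suc⇒≤ : ∀ {a r c} → a < r + suc c → a ≤ r + c
<+suc⇒≤ {a} {r} {c} lt = s≤s⁻¹ (subst (a <_) (+-suc r c) lt)


-- Sliding paths

data Move : Set where
  stop up left : Move

pickMove : Maybe ℕ → Maybe ℕ → Move
pickMove nothing  nothing   = stop
pickMove (just _) nothing   = left
pickMove nothing  (just _)  = up
pickMove (just a) (just a′) with a′ <? a
... | yes _ = left
... | no _  = up

nextMove : Filling → ℕ → ℕ → Move
nextMove T zero    zero    = stop
nextMove T zero    (suc c) = pickMove (T zero c) nothing
nextMove T (suc r) zero    = pickMove nothing (T r zero)
nextMove T (suc r) (suc c) = pickMove (T (suc r) c) (T r (suc c))

-- Every move of the path is read off the ORIGINAL filling T; this is
-- legitimate because a slide only touches boxes on antidiagonals r + c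
-- it has already passed.
data Path (T : Filling) : ℕ → ℕ → Box → Set where
  pathEnd  : ∀ {r c} → nextMove T r c ≡ stop → Path T r c (r , c)
  pathUp   : ∀ {r c x} → nextMove T (suc r) c ≡ up → Path T r c x → Path T (suc r) c x
  pathLeft : ∀ {r c x} → nextMove T r (suc c) ≡ left → Path T r c x → Path T r (suc c) x

slideAlong : ∀ {T r c x} → Path T r c x → Filling → Filling
slideAlong {r = r} {c} (pathEnd _) F = set r c nothing F
slideAlong {T} {suc r} {c} (pathUp _ P) F = set (suc r) c (T r c) (slideAlong P F)
slideAlong {T} {r} {suc c} (pathLeft _ P) F = set r (suc c) (T r c) (slideAlong P F)

slideAlong-set-higher : ∀ {T r c x} (P : Path T r c x) r₀ c₀ v F → r + c < r₀ + c₀ →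
  slideAlong P (set r₀ c₀ v F) ≐ set r₀ c₀ v (slideAlong P F)
slideAlong-set-higher {r = r} {c} (pathEnd _) r₀ c₀ v F lt =
  set-comm r c nothing r₀ c₀ v F (Diff-higher lt)
slideAlong-set-higher {T} {suc r} {c} (pathUp _ P) r₀ c₀ v F lt =
  ≐-trans (set-cong (suc r) c (T r c) (slideAlong-set-higher P r₀ c₀ v F (<-trans (n<1+n _) lt)))
          (set-comm (suc r) c (T r c) r₀ c₀ v (slideAlong P F) (Diff-higher lt))
slideAlong-set-higher {T} {r} {suc c} (pathLeft _ P) r₀ c₀ v F lt =
  ≐-trans (set-cong r (suc c) (T r c) (slideAlong-set-higher P r₀ c₀ v F (<-trans (r+c<r+1+c r c) lt)))
          (set-comm r (suc c) (T r c) r₀ c₀ v (slideAlong P F) (Diff-higher lt))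

slideAlong-set-start : ∀ {T r c x} (P : Path T r c x) v F → slideAlong P (set r c v F) ≐ slideAlong P F
slideAlong-set-start {r = r} {c} (pathEnd _) v F = set-set r c nothing v F
slideAlong-set-start {T} {suc r} {c} (pathUp _ P) v F =
  ≐-trans (set-cong (suc r) c (T r c) (slideAlong-set-higher P (suc r) c v F (n<1+n _)))
          (set-set (suc r) c (T r c) v (slideAlong P F))
slideAlong-set-start {T} {r} {suc c} (pathLeft _ P) v F =
  ≐-trans (set-cong r (suc c) (T r c) (slideAlong-set-higher P r (suc c) v F (r+c<r+1+c r c)))
          (set-set r (suc c) (T r c) v (slideAlong P F))

AgreeBelow : ℕ → Filling → Filling → Set
AgreeBelow d F G = ∀ r c → r + c < d → F r c ≡ G r c

-- The next move only depends on the two neighbours, which lie on the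
-- antidiagonal below.
nextMove-agree : ∀ {F G} r c → AgreeBelow (r + c) F G → nextMove F r c ≡ nextMove G r c
nextMove-agree zero zero ag = refl
nextMove-agree zero (suc c) ag = cong (λ v → pickMove v nothing) (ag zero c ≤-refl)
nextMove-agree (suc r) zero ag = cong (λ v → pickMove nothing v) (ag r zero ≤-refl)
nextMove-agree (suc r) (suc c) ag =
  cong₂ pickMove (ag (suc r) c (s≤s (≤-reflexive (sym (+-suc r c))))) (ag r (suc c) ≤-refl)

-- The outcome  s  of a slide from (r , c) is described by a path of T₀,
-- when run on a filling T that agrees with T₀ below the start.
SlideOutcome : Filling × Box → Filling → ℕ → ℕ → Filling → Set
SlideOutcome s T₀ r c T =
  Σ[ x ∈ Box ] Σ[ P ∈ Path T₀ r c x ] (proj₂ s ≡ x) × (proj₁ s ≐ slideAlong P T)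

outcome-stop : ∀ {r c} T₀ T → nextMove T₀ r c ≡ stop →
  SlideOutcome (set r c nothing T , (r , c)) T₀ r c T
outcome-stop T₀ T mv = _ , pathEnd mv , refl , λ _ _ → refl

outcome-left : ∀ {r c} s T₀ T → AgreeBelow (r + suc c) T₀ T → nextMove T₀ r (suc c) ≡ left →
  SlideOutcome s T₀ r c (move r c r (suc c) T) → SlideOutcome s T₀ r (suc c) T
outcome-left {r} {c} s T₀ T ag mv (x , P , e , res) = x , pathLeft mv P , e ,
  ≐-trans res (≐-trans (slideAlong-set-start P nothing (set r (suc c) (T r c) T))
    (≐-trans (slideAlong-set-higher P r (suc c) (T r c) T (r+c<r+1+c r c))
       (λ r′ c′ → cong (λ v → set r (suc c) v (slideAlong P T) r′ c′) (sym (ag r c (r+c<r+1+c r c))))))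

outcome-up : ∀ {r c} s T₀ T → AgreeBelow (suc r + c) T₀ T → nextMove T₀ (suc r) c ≡ up →
  SlideOutcome s T₀ r c (move r c (suc r) c T) → SlideOutcome s T₀ (suc r) c T
outcome-up {r} {c} s T₀ T ag mv (x , P , e , res) = x , pathUp mv P , e ,
  ≐-trans res (≐-trans (slideAlong-set-start P nothing (set (suc r) c (T r c) T))
    (≐-trans (slideAlong-set-higher P (suc r) c (T r c) T (n<1+n _))
       (λ r′ c′ → cong (λ v → set (suc r) c v (slideAlong P T) r′ c′) (sym (ag r c (n<1+n _))))))

move-agree : ∀ {d r c r′ c′} T₀ T → AgreeBelow d T₀ T → d ≤ r + c → d ≤ r′ + c′ →
  AgreeBelow d T₀ (move r c r′ c′ T)
move-agree {r = r} {c} {r′} {c′} T₀ T ag le le′ r₀ c₀ lt =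
  trans (ag r₀ c₀ lt)
    (sym (trans (set-other r c nothing (set r′ c′ (T r c) T) r₀ c₀ (Diff-lower (<-≤-trans lt le)))
                (set-other r′ c′ (T r c) T r₀ c₀ (Diff-lower (<-≤-trans lt le′)))))

agree-left : ∀ {r c} T₀ T → AgreeBelow (r + suc c) T₀ T → AgreeBelow (r + c) T₀ (move r c r (suc c) T)
agree-left {r} {c} T₀ T ag =
  move-agree T₀ T (λ r₀ c₀ lt → ag r₀ c₀ (<-trans lt (r+c<r+1+c r c))) ≤-refl (<⇒≤ (r+c<r+1+c r c))

agree-up : ∀ {r c} T₀ T → AgreeBelow (suc r + c) T₀ T → AgreeBelow (r + c) T₀ (move r c (suc r) c T)
agree-up T₀ T ag = move-agree T₀ T (λ r₀ c₀ lt → ag r₀ c₀ (<-trans lt (n<1+n _))) ≤-refl (n≤1+n _)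

slideFuel-outcome : ∀ f r c T₀ T → r + c ≤ f → AgreeBelow (r + c) T₀ T →
  SlideOutcome (slideFuel f r c T) T₀ r c T
slideFuel-outcome zero zero zero T₀ T le ag = outcome-stop T₀ T refl
slideFuel-outcome (suc f) zero zero T₀ T le ag = outcome-stop T₀ T refl
slideFuel-outcome (suc f) zero (suc c) T₀ T le ag with T zero c in e
... | nothing = outcome-stop T₀ T (trans (nextMove-agree zero (suc c) ag) (cong (λ v → pickMove v nothing) e))
... | just _ = outcome-left _ T₀ T ag (trans (nextMove-agree zero (suc c) ag) (cong (λ v → pickMove v nothing) e))
                 (slideFuel-outcome f zero c T₀ _ (s≤s⁻¹ le) (agree-left T₀ T ag))
slideFuel-outcome (suc f) (suc r) zero T₀ T le ag with T r zero in e
... | nothing = outcome-stop T₀ T (trans (nextMove-agree (suc r) zero ag) (cong (λ v → pickMove nothing v) e))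
... | just _ = outcome-up _ T₀ T ag (trans (nextMove-agree (suc r) zero ag) (cong (λ v → pickMove nothing v) e))
                 (slideFuel-outcome f r zero T₀ _ (s≤s⁻¹ le) (agree-up T₀ T ag))
slideFuel-outcome (suc f) (suc r) (suc c) T₀ T le ag with T (suc r) c in e₁ | T r (suc c) in e₂
... | nothing | nothing = outcome-stop T₀ T (trans (nextMove-agree (suc r) (suc c) ag) (cong₂ pickMove e₁ e₂))
... | just _ | nothing = outcome-left _ T₀ T ag (trans (nextMove-agree (suc r) (suc c) ag) (cong₂ pickMove e₁ e₂))
                 (slideFuel-outcome f (suc r) c T₀ _ (subst (_≤ f) (+-suc r c) (s≤s⁻¹ le)) (agree-left T₀ T ag))
... | nothing | just _ = outcome-up _ T₀ T ag (trans (nextMove-agree (suc r) (suc c) ag) (cong₂ pickMove e₁ e₂))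
                 (slideFuel-outcome f r (suc c) T₀ _ (s≤s⁻¹ le) (agree-up T₀ T ag))
... | just a | just a′ with a′ <? a in e₃
...   | yes _ = outcome-left _ T₀ T ag (trans (nextMove-agree (suc r) (suc c) ag) (trans (cong₂ pickMove e₁ e₂) picked))
                 (slideFuel-outcome f (suc r) c T₀ _ (subst (_≤ f) (+-suc r c) (s≤s⁻¹ le)) (agree-left T₀ T ag))
  where picked : pickMove (just a) (just a′) ≡ left
        picked rewrite e₃ = refl
...   | no _ = outcome-up _ T₀ T ag (trans (nextMove-agree (suc r) (suc c) ag) (trans (cong₂ pickMove e₁ e₂) picked))
                 (slideFuel-outcome f r (suc c) T₀ _ (s≤s⁻¹ le) (agree-up T₀ T ag))
  where picked : pickMove (just a) (just a′) ≡ up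
        picked rewrite e₃ = refl

revSlide-outcome : ∀ (h : Box) T → SlideOutcome (revSlide (proj₁ h) (proj₂ h) T) T (proj₁ h) (proj₂ h) T
revSlide-outcome h T = slideFuel-outcome (proj₁ h + proj₂ h) (proj₁ h) (proj₂ h) T T ≤-refl (λ _ _ _ → refl)

filled-and-empty : ∀ {m : Maybe ℕ} {a} → m ≡ just a → m ≡ nothing → ⊥
filled-and-empty refl ()

pickMove-stop : ∀ l u → pickMove l u ≡ stop → (l ≡ nothing) × (u ≡ nothing)
pickMove-stop nothing nothing _ = refl , refl
pickMove-stop (just a) (just a′) e with a′ <? a
pickMove-stop (just a) (just a′) () | yes _
pickMove-stop (just a) (just a′) () | no _

pickMove-up : ∀ l u → pickMove l u ≡ up → Σ[ a ∈ ℕ ] (u ≡ just a) × (∀ b → l ≡ just b → b ≤ a)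
pickMove-up nothing (just a) _ = a , refl , λ _ ()
pickMove-up (just b) (just a) e with a <? b
pickMove-up (just b) (just a) () | yes _
... | no a≮b = a , refl , λ { b′ refl → ≮⇒≥ a≮b }

pickMove-left : ∀ l u → pickMove l u ≡ left → Σ[ b ∈ ℕ ] (l ≡ just b) × (∀ a → u ≡ just a → a < b)
pickMove-left (just b) nothing _ = b , refl , λ _ ()
pickMove-left (just b) (just a) e with a <? b
... | yes a<b = b , refl , λ { a′ refl → a<b }
pickMove-left (just b) (just a) () | no _

stop⇒above-empty : ∀ T r c → nextMove T (suc r) c ≡ stop → T r c ≡ nothing
stop⇒above-empty T r zero e = proj₂ (pickMove-stop nothing (T r zero) e)
stop⇒above-empty T r (suc c) e = proj₂ (pickMove-stop (T (suc r) c) (T r (suc c)) e)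

stop⇒left-empty : ∀ T r c → nextMove T r (suc c) ≡ stop → T r c ≡ nothing
stop⇒left-empty T zero c e = proj₁ (pickMove-stop (T zero c) nothing e)
stop⇒left-empty T (suc r) c e = proj₁ (pickMove-stop (T (suc r) c) (T r (suc c)) e)

up⇒above-filled : ∀ T r c → nextMove T (suc r) c ≡ up → Σ[ a ∈ ℕ ] T r c ≡ just a
up⇒above-filled T r zero e = let (a , p , _) = pickMove-up nothing (T r zero) e in a , p
up⇒above-filled T r (suc c) e = let (a , p , _) = pickMove-up (T (suc r) c) (T r (suc c)) e in a , p

up⇒left≤above : ∀ T r c {l u} → nextMove T (suc r) (suc c) ≡ up →
  T (suc r) c ≡ just l → T r (suc c) ≡ just u → l ≤ u
up⇒left≤above T r c {l} e el eu with pickMove-up (T (suc r) c) (T r (suc c)) e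
... | a , p , q = subst (l ≤_) (just-injective (trans (sym p) eu)) (q l el)

left⇒left-filled : ∀ T r c → nextMove T r (suc c) ≡ left → Σ[ a ∈ ℕ ] T r c ≡ just a
left⇒left-filled T zero c e = let (a , p , _) = pickMove-left (T zero c) nothing e in a , p
left⇒left-filled T (suc r) c e = let (a , p , _) = pickMove-left (T (suc r) c) (T r (suc c)) e in a , p

left⇒above<left : ∀ T r c {l u} → nextMove T (suc r) (suc c) ≡ left →
  T (suc r) c ≡ just l → T r (suc c) ≡ just u → u < l
left⇒above<left T r c {u = u} e el eu with pickMove-left (T (suc r) c) (T r (suc c)) e
... | b , p , q = subst (u <_) (just-injective (trans (sym p) el)) (q u eu)

-- Young diagrams and the invariant of the box-sequence construction

In : YoungDiagram → ℕ → ℕ → Set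
In L r c = c < rowLen L r

rowLen-antitone : ∀ L {r′ r} → r′ ≤ r → rowLen L r ≤ rowLen L r′
rowLen-antitone L {r = zero} z≤n = ≤-refl
rowLen-antitone L {r = suc r} le with m≤n⇒m<n∨m≡n le
... | inj₁ lt = ≤-trans (weaklyDecreasing L r) (rowLen-antitone L (s≤s⁻¹ lt))
... | inj₂ refl = ≤-refl

In-down : ∀ L {r c r′ c′} → In L r c → r′ ≤ r → c′ ≤ c → In L r′ c′
In-down L i le₁ le₂ = <-≤-trans (≤-<-trans le₂ i) (rowLen-antitone L le₁)

-- The upper and left neighbours of (r , c) (when they exist) lie in L.
-- Every starting box b i of the construction has this property.
Inner : YoungDiagram → ℕ → ℕ → Set
Inner L r c = (∀ r′ → r ≡ suc r′ → In L r′ c) × (∀ c′ → c ≡ suc c′ → In L r c′)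

In⇒Inner : ∀ L r c → In L r c → Inner L r c
In⇒Inner L r c i = (λ { r′ refl → In-down L i (n≤1+n r′) ≤-refl })
                  , (λ { c′ refl → In-down L i ≤-refl (n≤1+n c′) })

-- The invariant satisfied by every U_k: a filling of a skew shape L/μ
-- (the empty boxes of L are closed towards the top-left), nothing outside
-- L, rows weakly and columns strictly increasing.  Weak rows suffice for
-- the argument and are preserved without tracking that entries are distinct.
record Inv (L : YoungDiagram) (T : Filling) : Set where
  field
    empty-outside : ∀ r c → ¬ In L r c → T r c ≡ nothing
    empty-closed  : ∀ r c r′ c′ → In L r c → T r c ≡ nothing → r′ ≤ r → c′ ≤ c → T r′ c′ ≡ nothing
    row-≤         : ∀ r c a a′ → T r c ≡ just a → T r (suc c) ≡ just a′ → a ≤ a′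
    col-<         : ∀ r c a a′ → T r c ≡ just a → T (suc r) c ≡ just a′ → a < a′
open Inv public

Inv-≐ : ∀ {L F G} → Inv L F → F ≐ G → Inv L G
Inv-≐ I e = record
  { empty-outside = λ r c ni → trans (sym (e r c)) (empty-outside I r c ni)
  ; empty-closed = λ r c r′ c′ i z le₁ le₂ →
      trans (sym (e r′ c′)) (empty-closed I r c r′ c′ i (trans (e r c) z) le₁ le₂)
  ; row-≤ = λ r c a a′ p q → row-≤ I r c a a′ (trans (e r c) p) (trans (e r (suc c)) q)
  ; col-< = λ r c a a′ p q → col-< I r c a a′ (trans (e r c) p) (trans (e (suc r) c) q)
  }

SYT⇒Inv : ∀ L U → IsSYT L U → Inv L U
SYT⇒Inv L U (filled , outside , _ , _ , rows , cols) = record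
  { empty-outside = outside
  ; empty-closed = λ r c _ _ i z _ _ → ⊥-elim (filled-and-empty (proj₂ (filled r c i)) z)
  ; row-≤ = λ r c a a′ p q → <⇒≤ (rows r c a a′ p q)
  ; col-< = cols
  }

filled⇒In : ∀ {L T} → Inv L T → ∀ r c {a} → T r c ≡ just a → In L r c
filled⇒In {L} I r c e with c <? rowLen L r
... | yes i = i
... | no ni = ⊥-elim (filled-and-empty e (empty-outside I r c ni))

filled-below : ∀ {L T} → Inv L T → ∀ r c r′ c′ {a} → In L r c → T r′ c′ ≡ just a → r′ ≤ r → c′ ≤ c →
  Σ[ b ∈ ℕ ] T r c ≡ just b
filled-below {T = T} I r c r′ c′ i e le₁ le₂ with T r c in eq
... | just b = b , refl
... | nothing = ⊥-elim (filled-and-empty e (empty-closed I r c r′ c′ i eq le₁ le₂))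

module _ {T : Filling} where

  data Suffix : ∀ {r′ c′ r c x} → Path T r′ c′ x → Path T r c x → Set where
    here : ∀ {r c x} {P : Path T r c x} → Suffix P P
    inUp : ∀ {r′ c′ r c x} {S : Path T r′ c′ x} {P : Path T r c x} {e} → Suffix S P → Suffix S (pathUp e P)
    inLeft : ∀ {r′ c′ r c x} {S : Path T r′ c′ x} {P : Path T r c x} {e} → Suffix S P → Suffix S (pathLeft e P)

  incoming : ∀ {r c x} → Path T r c x → Maybe ℕ
  incoming (pathEnd _) = nothing
  incoming (pathUp {r} {c} _ _) = T r c
  incoming (pathLeft {r} {c} _ _) = T r c

  path-le : ∀ {r c x} → Path T r c x → (proj₁ x ≤ r) × (proj₂ x ≤ c)
  path-le (pathEnd _) = ≤-refl , ≤-refl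
  path-le (pathUp _ P) = let (a , b) = path-le P in m≤n⇒m≤1+n a , b
  path-le (pathLeft _ P) = let (a , b) = path-le P in a , m≤n⇒m≤1+n b

  path-antidiag : ∀ {r c x} → Path T r c x → proj₁ x + proj₂ x ≤ r + c
  path-antidiag P = let (a , b) = path-le P in +-mono-≤ a b

  path-stop : ∀ {r c x} → Path T r c x → nextMove T (proj₁ x) (proj₂ x) ≡ stop
  path-stop (pathEnd e) = e
  path-stop (pathUp _ P) = path-stop P
  path-stop (pathLeft _ P) = path-stop P

  Suffix-le : ∀ {r′ c′ r c x} {S : Path T r′ c′ x} {P : Path T r c x} → Suffix S P → (r′ ≤ r) × (c′ ≤ c)
  Suffix-le here = ≤-refl , ≤-refl
  Suffix-le (inUp s) = let (a , b) = Suffix-le s in m≤n⇒m≤1+n a , b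
  Suffix-le (inLeft s) = let (a , b) = Suffix-le s in a , m≤n⇒m≤1+n b

  Suffix-antidiag : ∀ {r′ c′ r c x} {S : Path T r′ c′ x} {P : Path T r c x} → Suffix S P → r′ + c′ ≤ r + c
  Suffix-antidiag s = let (a , b) = Suffix-le s in +-mono-≤ a b

  Suffix-trans : ∀ {r₁ c₁ r₂ c₂ r₃ c₃ x} {A : Path T r₁ c₁ x} {B : Path T r₂ c₂ x} {C : Path T r₃ c₃ x} →
    Suffix A B → Suffix B C → Suffix A C
  Suffix-trans s here = s
  Suffix-trans s (inUp t) = inUp (Suffix-trans s t)
  Suffix-trans s (inLeft t) = inLeft (Suffix-trans s t)

  slideAlong-start : ∀ {r c x} (P : Path T r c x) F → slideAlong P F r c ≡ incoming P
  slideAlong-start {r} {c} (pathEnd _) F = set-same r c nothing F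
  slideAlong-start {suc r} {c} (pathUp _ P) F = set-same (suc r) c (T r c) (slideAlong P F)
  slideAlong-start {r} {suc c} (pathLeft _ P) F = set-same r (suc c) (T r c) (slideAlong P F)

  slideAlong-suffix : ∀ {r′ c′ r c x} {S : Path T r′ c′ x} {P : Path T r c x} → Suffix S P → ∀ F r₀ c₀ →
    r₀ + c₀ ≤ r′ + c′ → slideAlong P F r₀ c₀ ≡ slideAlong S F r₀ c₀
  slideAlong-suffix here F r₀ c₀ le = refl
  slideAlong-suffix {P = pathUp {r} {c} _ P} (inUp s) F r₀ c₀ le =
    trans (set-other (suc r) c (T r c) (slideAlong P F) r₀ c₀ (Diff-lower (≤-<-trans (≤-trans le (Suffix-antidiag s)) (n<1+n _))))
          (slideAlong-suffix s F r₀ c₀ le)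
  slideAlong-suffix {P = pathLeft {r} {c} _ P} (inLeft s) F r₀ c₀ le =
    trans (set-other r (suc c) (T r c) (slideAlong P F) r₀ c₀ (Diff-lower (≤-<-trans (≤-trans le (Suffix-antidiag s)) (r+c<r+1+c r c))))
          (slideAlong-suffix s F r₀ c₀ le)

  slideAlong-incoming : ∀ {r′ c′ r c x} {S : Path T r′ c′ x} {P : Path T r c x} → Suffix S P → ∀ F →
    slideAlong P F r′ c′ ≡ incoming S
  slideAlong-incoming {r′} {c′} {S = S} s F = trans (slideAlong-suffix s F r′ c′ ≤-refl) (slideAlong-start S F)

  slideAlong-higher : ∀ {r c x} (P : Path T r c x) F r₀ c₀ → r + c ≤ r₀ + c₀ → Diff r c r₀ c₀ →
    slideAlong P F r₀ c₀ ≡ F r₀ c₀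
  slideAlong-higher {r} {c} (pathEnd _) F r₀ c₀ le d = set-other r c nothing F r₀ c₀ d
  slideAlong-higher {suc r} {c} (pathUp _ P) F r₀ c₀ le d =
    trans (set-other (suc r) c (T r c) (slideAlong P F) r₀ c₀ d)
      (slideAlong-higher P F r₀ c₀ (≤-trans (n≤1+n _) le) (Diff-higher le))
  slideAlong-higher {r} {suc c} (pathLeft _ P) F r₀ c₀ le d =
    trans (set-other r (suc c) (T r c) (slideAlong P F) r₀ c₀ d)
      (slideAlong-higher P F r₀ c₀ (≤-trans (<⇒≤ (r+c<r+1+c r c)) le) (Diff-higher (<-≤-trans (r+c<r+1+c r c) le)))

  slideAlong-lower : ∀ {r c x} (P : Path T r c x) F r₀ c₀ → r₀ + c₀ < proj₁ x + proj₂ x →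
    slideAlong P F r₀ c₀ ≡ F r₀ c₀
  slideAlong-lower {r} {c} (pathEnd _) F r₀ c₀ lt = set-other r c nothing F r₀ c₀ (Diff-lower lt)
  slideAlong-lower {suc r} {c} (pathUp _ P) F r₀ c₀ lt =
    trans (set-other (suc r) c (T r c) (slideAlong P F) r₀ c₀ (Diff-lower (<-≤-trans lt (≤-trans (path-antidiag P) (n≤1+n _)))))
      (slideAlong-lower P F r₀ c₀ lt)
  slideAlong-lower {r} {suc c} (pathLeft _ P) F r₀ c₀ lt =
    trans (set-other r (suc c) (T r c) (slideAlong P F) r₀ c₀ (Diff-lower (<-≤-trans lt (≤-trans (path-antidiag P) (<⇒≤ (r+c<r+1+c r c))))))
      (slideAlong-lower P F r₀ c₀ lt)

  on-path-or-untouched : ∀ {r c x} (P : Path T r c x) F r₀ c₀ →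
    (Σ[ S ∈ Path T r₀ c₀ x ] Suffix S P) ⊎ (slideAlong P F r₀ c₀ ≡ F r₀ c₀)
  on-path-or-untouched {r} {c} P F r₀ c₀ with Diff? r c r₀ c₀
  on-path-or-untouched P F r₀ c₀ | inj₁ (refl , refl) = inj₁ (P , here)
  on-path-or-untouched {r} {c} (pathEnd _) F r₀ c₀ | inj₂ d = inj₂ (set-other r c nothing F r₀ c₀ d)
  on-path-or-untouched {suc r} {c} (pathUp _ P) F r₀ c₀ | inj₂ d with on-path-or-untouched P F r₀ c₀
  ... | inj₁ (S , s) = inj₁ (S , inUp s)
  ... | inj₂ e = inj₂ (trans (set-other (suc r) c (T r c) (slideAlong P F) r₀ c₀ d) e)
  on-path-or-untouched {r} {suc c} (pathLeft _ P) F r₀ c₀ | inj₂ d with on-path-or-untouched P F r₀ c₀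
  ... | inj₁ (S , s) = inj₁ (S , inLeft s)
  ... | inj₂ e = inj₂ (trans (set-other r (suc c) (T r c) (slideAlong P F) r₀ c₀ d) e)

  Suffix-unique : ∀ {r₁ c₁ r₂ c₂ r c x} {S₁ : Path T r₁ c₁ x} {S₂ : Path T r₂ c₂ x} {P : Path T r c x} →
    Suffix S₁ P → Suffix S₂ P → r₁ + c₁ ≡ r₂ + c₂ → (r₁ ≡ r₂) × (c₁ ≡ c₂)
  Suffix-unique here here e = refl , refl
  Suffix-unique here (inUp s) e = ⊥-elim (<-irrefl (sym e) (s≤s (Suffix-antidiag s)))
  Suffix-unique here (inLeft {r = r} {c} s) e = ⊥-elim (<-irrefl (sym e) (≤-<-trans (Suffix-antidiag s) (r+c<r+1+c r c)))
  Suffix-unique (inUp s) here e = ⊥-elim (<-irrefl e (s≤s (Suffix-antidiag s)))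
  Suffix-unique (inLeft {r = r} {c} s) here e = ⊥-elim (<-irrefl e (≤-<-trans (Suffix-antidiag s) (r+c<r+1+c r c)))
  Suffix-unique (inUp s) (inUp t) e = Suffix-unique s t e
  Suffix-unique (inLeft s) (inLeft t) e = Suffix-unique s t e

  Suffix-filled : ∀ {r′ c′ r c x} {S : Path T r′ c′ x} {P : Path T r c x} → Suffix S P →
    (r′ ≡ r × c′ ≡ c) ⊎ (Σ[ a ∈ ℕ ] T r′ c′ ≡ just a)
  Suffix-filled here = inj₁ (refl , refl)
  Suffix-filled (inUp {r = r} {c} {e = e} s) with Suffix-filled s
  ... | inj₁ (refl , refl) = inj₂ (up⇒above-filled T r c e)
  ... | inj₂ f = inj₂ f
  Suffix-filled (inLeft {r = r} {c} {e = e} s) with Suffix-filled s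
  ... | inj₁ (refl , refl) = inj₂ (left⇒left-filled T r c e)
  ... | inj₂ f = inj₂ f

  Suffix-exists : ∀ {r c x} (P : Path T r c x) d → proj₁ x + proj₂ x ≤ d → d ≤ r + c →
    Σ[ r′ ∈ ℕ ] Σ[ c′ ∈ ℕ ] Σ[ S ∈ Path T r′ c′ x ] Suffix S P × (r′ + c′ ≡ d)
  Suffix-exists {r} {c} P d le1 le2 with d ≟ r + c
  ... | yes e = r , c , P , here , sym e
  Suffix-exists (pathEnd _) d le1 le2 | no ne = ⊥-elim (ne (≤-antisym le2 le1))
  Suffix-exists (pathUp _ P) d le1 le2 | no ne with Suffix-exists P d le1 (s≤s⁻¹ (≤∧≢⇒< le2 ne))
  ... | r′ , c′ , S , s , e = r′ , c′ , S , inUp s , e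
  Suffix-exists {r} {suc c} (pathLeft _ P) d le1 le2 | no ne
    with Suffix-exists P d le1 (s≤s⁻¹ (subst (d <_) (+-suc r c) (≤∧≢⇒< le2 ne)))
  ... | r′ , c′ , S , s , e = r′ , c′ , S , inLeft s , e

  path-crosses-row : ∀ {r c x} → Path T r c x → ∀ r₀ → proj₁ x ≤ r₀ → r₀ < r →
    Σ[ c₀ ∈ ℕ ] Σ[ a ∈ ℕ ] (c₀ ≤ c) × (T r₀ c₀ ≡ just a)
  path-crosses-row (pathEnd _) r₀ le lt = ⊥-elim (<-irrefl refl (≤-<-trans le lt))
  path-crosses-row (pathUp {r} {c} e P) r₀ le lt with r₀ ≟ r
  ... | yes refl = let (a , p) = up⇒above-filled T r c e in c , a , ≤-refl , p
  ... | no ne = let (c₀ , a , q , p) = path-crosses-row P r₀ le (≤∧≢⇒< (s≤s⁻¹ lt) ne) in c₀ , a , q , p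
  path-crosses-row (pathLeft e P) r₀ le lt = let (c₀ , a , q , p) = path-crosses-row P r₀ le lt in c₀ , a , m≤n⇒m≤1+n q , p

  path-crosses-col : ∀ {r c x} → Path T r c x → ∀ c₀ → proj₂ x ≤ c₀ → c₀ < c →
    Σ[ r₀ ∈ ℕ ] Σ[ a ∈ ℕ ] (r₀ ≤ r) × (T r₀ c₀ ≡ just a)
  path-crosses-col (pathEnd _) c₀ le lt = ⊥-elim (<-irrefl refl (≤-<-trans le lt))
  path-crosses-col (pathLeft {r} {c} e P) c₀ le lt with c₀ ≟ c
  ... | yes refl = let (a , p) = left⇒left-filled T r c e in r , a , ≤-refl , p
  ... | no ne = let (r₀ , a , q , p) = path-crosses-col P c₀ le (≤∧≢⇒< (s≤s⁻¹ lt) ne) in r₀ , a , q , p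
  path-crosses-col (pathUp e P) c₀ le lt = let (r₀ , a , q , p) = path-crosses-col P c₀ le lt in r₀ , a , m≤n⇒m≤1+n q , p



  Suffix-chain : ∀ {r₁ c₁ r₂ c₂ r c x} {S₁ : Path T r₁ c₁ x} {S₂ : Path T r₂ c₂ x} {P : Path T r c x} →
    Suffix S₁ P → Suffix S₂ P → r₂ + c₂ ≤ r₁ + c₁ → Suffix S₂ S₁
  Suffix-chain here s₂ le = s₂
  Suffix-chain (inUp s₁) here le = ⊥-elim (<-irrefl refl (≤-<-trans le (s≤s (Suffix-antidiag s₁))))
  Suffix-chain (inLeft {r = r} {c} s₁) here le = ⊥-elim (<-irrefl refl (≤-<-trans le (≤-<-trans (Suffix-antidiag s₁) (r+c<r+1+c r c))))
  Suffix-chain (inUp s₁) (inUp s₂) le = Suffix-chain s₁ s₂ le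
  Suffix-chain (inLeft s₁) (inLeft s₂) le = Suffix-chain s₁ s₂ le

  path-end-filled : ∀ {r c x} → Path T r c x → (x ≡ (r , c)) ⊎ (Σ[ a ∈ ℕ ] T (proj₁ x) (proj₂ x) ≡ just a)
  path-end-filled (pathEnd _) = inj₁ refl
  path-end-filled (pathUp {r} {c} e P) with path-end-filled P
  ... | inj₁ refl = inj₂ (up⇒above-filled T r c e)
  ... | inj₂ f = inj₂ f
  path-end-filled (pathLeft {r} {c} e P) with path-end-filled P
  ... | inj₁ refl = inj₂ (left⇒left-filled T r c e)
  ... | inj₂ f = inj₂ f

  slideAlong-end : ∀ {r c x} (P : Path T r c x) F → slideAlong P F (proj₁ x) (proj₂ x) ≡ nothing
  slideAlong-end {r = r} {c} (pathEnd _) F = set-same r c nothing F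
  slideAlong-end (pathUp {r} {c} _ P) F =
    trans (set-other (suc r) c (T r c) (slideAlong P F) _ _ (Diff-lower (≤-<-trans (path-antidiag P) (n<1+n _))))
          (slideAlong-end P F)
  slideAlong-end (pathLeft {r} {c} _ P) F =
    trans (set-other r (suc c) (T r c) (slideAlong P F) _ _ (Diff-lower (≤-<-trans (path-antidiag P) (r+c<r+1+c r c))))
          (slideAlong-end P F)

stop⇒empty-above-left : ∀ {L T} → Inv L T → ∀ r c r′ c′ → In L r c → nextMove T r c ≡ stop →
  r′ ≤ r → c′ ≤ c → Diff r c r′ c′ → T r′ c′ ≡ nothing
stop⇒empty-above-left I r c r′ c′ i e le₁ le₂ d with r′ ≟ r | c′ ≟ c
... | yes p | yes q = ⊥-elim (d (p , q))
stop⇒empty-above-left {L} {T} I (suc r) c r′ c′ i e le₁ le₂ d | no p | _ =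
  empty-closed I r c r′ c′ (In-down L i (n≤1+n r) ≤-refl) (stop⇒above-empty T r c e) (s≤s⁻¹ (≤∧≢⇒< le₁ p)) le₂
stop⇒empty-above-left I zero c r′ c′ i e z≤n le₂ d | no p | _ = ⊥-elim (p refl)
stop⇒empty-above-left {L} {T} I r (suc c) r′ c′ i e le₁ le₂ d | yes _ | no q =
  empty-closed I r c r′ c′ (In-down L i ≤-refl (n≤1+n c)) (stop⇒left-empty T r c e) le₁ (s≤s⁻¹ (≤∧≢⇒< le₂ q))
stop⇒empty-above-left I r zero r′ c′ i e le₁ z≤n d | yes _ | no q = ⊥-elim (q refl)

module SlideStep (L : YoungDiagram) (T : Filling) (I : Inv L T) (rb cb : ℕ) (h∉L : ¬ In L rb cb)
                 (h-inner : Inner L rb cb) {x : Box} (P : Path T rb cb x) where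

  Slid : Filling
  Slid = slideAlong P T

  Next : Filling
  Next = set rb cb nothing Slid

  start-In : ∀ {r c} {S : Path T r c x} → Suffix S P → (r ≡ rb × c ≡ cb) ⊎ In L r c
  start-In s with Suffix-filled s
  ... | inj₁ e = inj₁ e
  ... | inj₂ (_ , p) = inj₂ (filled⇒In I _ _ p)

  start-Inner : ∀ {r c} {S : Path T r c x} → Suffix S P → Inner L r c
  start-Inner s with start-In s
  ... | inj₁ (refl , refl) = h-inner
  ... | inj₂ i = In⇒Inner L _ _ i

  -- empty boxes of L stay empty under the slide (the path avoids them)
  Slid-empty : ∀ r c → In L r c → T r c ≡ nothing → Slid r c ≡ nothing
  Slid-empty r c i z with on-path-or-untouched P T r c
  ... | inj₂ e = trans e z
  ... | inj₁ (S , s) with Suffix-filled s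
  ...   | inj₁ (refl , refl) = ⊥-elim (h∉L i)
  ...   | inj₂ (_ , p) = ⊥-elim (filled-and-empty p z)

  Next-empty : ∀ r c → Slid r c ≡ nothing → Next r c ≡ nothing
  Next-empty r c e with Diff? rb cb r c
  ... | inj₁ (refl , refl) = set-same rb cb nothing Slid
  ... | inj₂ d = trans (set-other rb cb nothing Slid r c d) e

  Next-filled : ∀ r c {a} → Next r c ≡ just a → Slid r c ≡ just a
  Next-filled r c e with Diff? rb cb r c
  ... | inj₁ (refl , refl) = ⊥-elim (filled-and-empty e (set-same rb cb nothing Slid))
  ... | inj₂ d = trans (sym (set-other rb cb nothing Slid r c d)) e

  Slid-incoming : ∀ {r c} {S : Path T r c x} → Suffix S P → ∀ {a} → Slid r c ≡ just a → incoming S ≡ just a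
  Slid-incoming s e = trans (sym (slideAlong-incoming s T)) e

  -- Cases: both boxes off the path; only the
  -- left one on it (it received a neighbour of itself, which is ≤ its
  -- right neighbour); the right one on it (it received its left neighbour,
  -- or its upper neighbour which the slide preferred to the left one).
  Slid-row-≤ : ∀ r c a a′ → Slid r c ≡ just a → Slid r (suc c) ≡ just a′ → a ≤ a′
  Slid-row-≤ r c a a′ eu ev with on-path-or-untouched P T r (suc c)
  Slid-row-≤ r c a a′ eu ev | inj₂ ev′ with on-path-or-untouched P T r c
  ... | inj₂ eu′ = row-≤ I r c a a′ (trans (sym eu′) eu) (trans (sym ev′) ev)
  ... | inj₁ (S , s) = left-on-path S (Slid-incoming s eu)
    where
    Tv : T r (suc c) ≡ just a′
    Tv = trans (sym ev′) ev
    u∈L : In L r c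
    u∈L = In-down L (filled⇒In I r (suc c) Tv) ≤-refl (n≤1+n c)
    left-on-path : (S : Path T r c x) → incoming S ≡ just a → a ≤ a′
    left-on-path (pathUp {r₀} _ _) p = let (b , Tu) = filled-below I (suc r₀) c r₀ c u∈L p (n≤1+n r₀) ≤-refl in
      ≤-trans (<⇒≤ (col-< I r₀ c a b p Tu)) (row-≤ I (suc r₀) c b a′ Tu Tv)
    left-on-path (pathLeft {c = c₀} _ _) p = let (b , Tu) = filled-below I r (suc c₀) r c₀ u∈L p ≤-refl (n≤1+n c₀) in
      ≤-trans (row-≤ I r c₀ a b p Tu) (row-≤ I r (suc c₀) b a′ Tu Tv)
  Slid-row-≤ r c a a′ eu ev | inj₁ (S , s) = right-on-path S s (Slid-incoming s ev)
    where
    right-on-path : (S : Path T r (suc c) x) → Suffix S P → incoming S ≡ just a′ → a ≤ a′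
    right-on-path (pathUp {r₀} e S′) s p with on-path-or-untouched P T (suc r₀) c
    ... | inj₂ eu′ = up⇒left≤above T r₀ c e (trans (sym eu′) eu) p
    ... | inj₁ (S₂ , s₂) = ⊥-elim (1+n≢n (proj₁ (Suffix-unique s₂ (Suffix-trans (inUp here) s) (sym (+-suc r₀ c)))))
    right-on-path (pathLeft e S′) s p = from-neighbour S′ (Slid-incoming (Suffix-trans (inLeft here) s) eu)
      where
      from-neighbour : (S′ : Path T r c x) → incoming S′ ≡ just a → a ≤ a′
      from-neighbour (pathUp {r₁} _ _) q = <⇒≤ (col-< I r₁ c a a′ q p)
      from-neighbour (pathLeft {c = c₁} _ _) q = row-≤ I r c₁ a a′ q p

  Slid-col-< : ∀ r c a a′ → Slid r c ≡ just a → Slid (suc r) c ≡ just a′ → a < a′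
  Slid-col-< r c a a′ eu ev with on-path-or-untouched P T (suc r) c
  Slid-col-< r c a a′ eu ev | inj₂ ev′ with on-path-or-untouched P T r c
  ... | inj₂ eu′ = col-< I r c a a′ (trans (sym eu′) eu) (trans (sym ev′) ev)
  ... | inj₁ (S , s) = upper-on-path S (Slid-incoming s eu)
    where
    Tv : T (suc r) c ≡ just a′
    Tv = trans (sym ev′) ev
    u∈L : In L r c
    u∈L = In-down L (filled⇒In I (suc r) c Tv) (n≤1+n r) ≤-refl
    upper-on-path : (S : Path T r c x) → incoming S ≡ just a → a < a′
    upper-on-path (pathUp {r₀} _ _) p = let (b , Tu) = filled-below I (suc r₀) c r₀ c u∈L p (n≤1+n r₀) ≤-refl in
      <-trans (col-< I r₀ c a b p Tu) (col-< I (suc r₀) c b a′ Tu Tv)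
    upper-on-path (pathLeft {c = c₀} _ _) p = let (b , Tu) = filled-below I r (suc c₀) r c₀ u∈L p ≤-refl (n≤1+n c₀) in
      ≤-<-trans (row-≤ I r c₀ a b p Tu) (col-< I r (suc c₀) b a′ Tu Tv)
  Slid-col-< r c a a′ eu ev | inj₁ (S , s) = lower-on-path S s (Slid-incoming s ev)
    where
    lower-on-path : (S : Path T (suc r) c x) → Suffix S P → incoming S ≡ just a′ → a < a′
    lower-on-path (pathUp e S′) s p = from-neighbour S′ (Slid-incoming (Suffix-trans (inUp here) s) eu)
      where
      from-neighbour : (S′ : Path T r c x) → incoming S′ ≡ just a → a < a′
      from-neighbour (pathUp {r₁} _ _) q = col-< I r₁ c a a′ q p
      from-neighbour (pathLeft {c = c₁} _ _) q =
        let (l , Tl) = filled-below I (suc r) c₁ r c₁ (proj₂ (start-Inner s) c₁ refl) q (n≤1+n r) ≤-refl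
        in <-≤-trans (col-< I r c₁ a l q Tl) (up⇒left≤above T r c₁ e Tl p)
    lower-on-path (pathLeft {c = c₀} e S′) s p with on-path-or-untouched P T r (suc c₀)
    ... | inj₂ eu′ = left⇒above<left T r c₀ e p (trans (sym eu′) eu)
    ... | inj₁ (S₂ , s₂) = ⊥-elim (1+n≢n (sym (proj₁ (Suffix-unique s₂ (Suffix-trans (inLeft here) s) (+-suc r c₀)))))

  Next-empty-outside : ∀ r c → ¬ In L r c → Next r c ≡ nothing
  Next-empty-outside r c ni with Diff? rb cb r c
  ... | inj₁ (refl , refl) = set-same rb cb nothing Slid
  ... | inj₂ d with on-path-or-untouched P T r c
  ...   | inj₂ e = trans (set-other rb cb nothing Slid r c d) (trans e (empty-outside I r c ni))
  ...   | inj₁ (S , s) with start-In s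
  ...     | inj₁ (refl , refl) = ⊥-elim (d (refl , refl))
  ...     | inj₂ i = ⊥-elim (ni i)

  -- An empty box of L after the step was empty before, or is the end of
  -- the path; either way everything above-left of it was and stays empty.
  Next-empty-closed : ∀ r c r′ c′ → In L r c → Next r c ≡ nothing → r′ ≤ r → c′ ≤ c → Next r′ c′ ≡ nothing
  Next-empty-closed r c r′ c′ i z le₁ le₂ = Next-empty r′ c′ (by-cases (on-path-or-untouched P T r c))
    where
    i′ : In L r′ c′
    i′ = In-down L i le₁ le₂
    Slid-z : Slid r c ≡ nothing
    Slid-z = trans (sym (set-other rb cb nothing Slid r c (λ { (refl , refl) → h∉L i }))) z
    by-cases : (Σ[ S ∈ Path T r c x ] Suffix S P) ⊎ (Slid r c ≡ T r c) → Slid r′ c′ ≡ nothing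
    by-cases (inj₂ e) = Slid-empty r′ c′ i′ (empty-closed I r c r′ c′ i (trans (sym e) Slid-z) le₁ le₂)
    by-cases (inj₁ (S , s)) = at-end S (trans (sym (slideAlong-incoming s T)) Slid-z)
      where
      at-end : (S : Path T r c x) → incoming S ≡ nothing → Slid r′ c′ ≡ nothing
      at-end (pathEnd e) _ with Diff? r c r′ c′
      ... | inj₁ (refl , refl) = Slid-z
      ... | inj₂ d = Slid-empty r′ c′ i′ (stop⇒empty-above-left I r c r′ c′ i e le₁ le₂ d)
      at-end (pathUp {r₀} e _) v = ⊥-elim (filled-and-empty (proj₂ (up⇒above-filled T r₀ c e)) v)
      at-end (pathLeft {c = c₀} e _) v = ⊥-elim (filled-and-empty (proj₂ (left⇒left-filled T r c₀ e)) v)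

  Next-Inv : Inv L Next
  Next-Inv = record
    { empty-outside = Next-empty-outside
    ; empty-closed = Next-empty-closed
    ; row-≤ = λ r c a a′ p q → Slid-row-≤ r c a a′ (Next-filled r c p) (Next-filled r (suc c) q)
    ; col-< = λ r c a a′ p q → Slid-col-< r c a a′ (Next-filled r c p) (Next-filled (suc r) c q)
    }

-- Two consecutive slides

-- We follow a second slide Q through T′ and
-- show that it stays on one side of P:
--   NE r c : (r , c) is strictly north-east of P, i.e. strictly above-right
--            of h beyond its antidiagonal, strictly right of the box of P on
--            its antidiagonal, on the target of a left step of P, or
--            weakly above-right of x (but not x);
--   SW r c : the mirror-image statement (south-west).
-- NE holds at the start of Q if Q starts above-right of h, is preserved by
-- every move of Q, and at the end of Q it says that Q ends above-right of x.
module Consecutive (L : YoungDiagram) (T : Filling) (I : Inv L T) (rb cb : ℕ) (h∉L : ¬ In L rb cb)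
                   (h-inner : Inner L rb cb) {x : Box} (P : Path T rb cb x)
                   (T′ : Filling) (T′≐Next : T′ ≐ SlideStep.Next L T I rb cb h∉L h-inner P) where

  open SlideStep L T I rb cb h∉L h-inner P

  I′ : Inv L T′
  I′ = Inv-≐ Next-Inv (≐-sym T′≐Next)

  xr xc : ℕ
  xr = row x
  xc = col x

  T′-slid : ∀ r₀ c₀ → Diff rb cb r₀ c₀ → T′ r₀ c₀ ≡ Slid r₀ c₀
  T′-slid r₀ c₀ d = trans (T′≐Next r₀ c₀) (set-other rb cb nothing Slid r₀ c₀ d)

  T′-higher : ∀ r₀ c₀ → rb + cb < r₀ + c₀ → T′ r₀ c₀ ≡ T r₀ c₀
  T′-higher r₀ c₀ lt = trans (T′-slid r₀ c₀ (Diff-higher lt)) (slideAlong-higher P T r₀ c₀ (<⇒≤ lt) (Diff-higher lt))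

  T′-lower : ∀ r₀ c₀ → r₀ + c₀ < xr + xc → T′ r₀ c₀ ≡ T r₀ c₀
  T′-lower r₀ c₀ lt = trans (T′-slid r₀ c₀ (Diff-lower (<-≤-trans lt (path-antidiag P)))) (slideAlong-lower P T r₀ c₀ lt)

  T′-off-path : ∀ {r′ c′} {S : Path T r′ c′ x} → Suffix S P → ∀ r₀ c₀ → r₀ + c₀ ≤ r′ + c′ →
    (c′ < c₀ ⊎ r′ < r₀) → Diff rb cb r₀ c₀ → T′ r₀ c₀ ≡ T r₀ c₀
  T′-off-path s r₀ c₀ le off d with on-path-or-untouched P T r₀ c₀
  ... | inj₂ e = trans (T′-slid r₀ c₀ d) e
  ... | inj₁ (_ , s₂) with Suffix-le (Suffix-chain s s₂ le) | off
  ...   | (_ , le-c) | inj₁ lt = ⊥-elim (<-irrefl refl (<-≤-trans lt le-c))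
  ...   | (le-r , _) | inj₂ lt = ⊥-elim (<-irrefl refl (<-≤-trans lt le-r))

  T′-right-of-h : ∀ r₀ c₀ → rb + cb ≤ r₀ + c₀ → cb < c₀ → T′ r₀ c₀ ≡ T r₀ c₀
  T′-right-of-h r₀ c₀ le lt with rb + cb <? r₀ + c₀
  ... | yes p = T′-higher r₀ c₀ p
  ... | no ¬p = T′-off-path here r₀ c₀ (≮⇒≥ ¬p) (inj₁ lt) (λ { (refl , refl) → <-irrefl refl lt })

  T′-below-h : ∀ r₀ c₀ → rb + cb ≤ r₀ + c₀ → rb < r₀ → T′ r₀ c₀ ≡ T r₀ c₀
  T′-below-h r₀ c₀ le lt with rb + cb <? r₀ + c₀
  ... | yes p = T′-higher r₀ c₀ p
  ... | no ¬p = T′-off-path here r₀ c₀ (≮⇒≥ ¬p) (inj₂ lt) (λ { (refl , refl) → <-irrefl refl lt })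

  T′-incoming : ∀ {r′ c′} {S : Path T r′ c′ x} → Suffix S P → Diff rb cb r′ c′ → T′ r′ c′ ≡ incoming S
  T′-incoming {r′} {c′} s d = trans (T′-slid r′ c′ d) (slideAlong-incoming s T)

  T′-x-empty : T′ xr xc ≡ nothing
  T′-x-empty = trans (T′≐Next xr xc) (Next-empty xr xc (slideAlong-end P T))

  T′-h-empty : T′ rb cb ≡ nothing
  T′-h-empty = trans (T′≐Next rb cb) (set-same rb cb nothing Slid)

  filled⇒≠x : ∀ r c {a} → T′ r c ≡ just a → Diff xr xc r c
  filled⇒≠x r c e (refl , refl) = filled-and-empty e T′-x-empty

  filled⇒≠h : ∀ r c {a} → T′ r c ≡ just a → Diff rb cb r c
  filled⇒≠h r c e (refl , refl) = filled-and-empty e T′-h-empty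

  In⇒≠h : ∀ r c → In L r c → Diff rb cb r c
  In⇒≠h r c i (refl , refl) = h∉L i

  -- Q moves only into filled boxes, whose neighbours lie in L
  filled⇒Inner : ∀ r c {a} → T′ r c ≡ just a → Inner L r c
  filled⇒Inner r c e = In⇒Inner L r c (filled⇒In I′ r c e)

  x-inner : Inner L xr xc
  x-inner with path-end-filled P
  ... | inj₁ refl = h-inner
  ... | inj₂ (_ , p) = In⇒Inner L xr xc (filled⇒In I xr xc p)

  AboveRightOfEnd : Box → Set
  AboveRightOfEnd x′ = ((xc ≤ col x′) × (row x′ ≤ xr)) × Diff xr xc (row x′) (col x′)

  data NE : ℕ → ℕ → Set where
    ne-beyond       : ∀ {r c} → rb + cb < r + c → r < rb → NE r c
    ne-beside       : ∀ {r c r′ c′} (S : Path T r′ c′ x) → Suffix S P → r′ + c′ ≡ r + c → c′ < c → NE r c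
    ne-on-left-step : ∀ {r c} {e} (S : Path T r c x) → Suffix (pathLeft e S) P → NE r (suc c)
    ne-end          : ∀ {r c} → r ≤ xr → xc ≤ c → Diff xr xc r c → NE r c

  ne-start : ∀ rj cj → rj < rb → cb < cj → NE rj cj
  ne-start rj cj lt₁ lt₂ with rb + cb <? rj + cj
  ... | yes p = ne-beyond p lt₁
  ... | no ¬p with xr + xc ≤? rj + cj
  ...   | yes q = let (_ , _ , S , s , eq) = Suffix-exists P (rj + cj) q (≮⇒≥ ¬p)
                  in ne-beside S s eq (≤-<-trans (proj₂ (Suffix-le s)) lt₂)
  ...   | no ¬q = let lower = ≰⇒> ¬q
                      right = ≤-<-trans (proj₂ (path-le P)) lt₂
                  in ne-end (<⇒≤ (lower-right⇒above lower right)) (<⇒≤ right) (Diff-lower lower)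

  -- Q cannot move left onto a box of P that P entered from below: the
  -- entry slid down by P would be smaller than its right neighbour, which
  -- is ≥ the entry Q moves, contradicting the rule of the slide.
  left-onto-path : ∀ {r c} (S : Path T r c x) → Suffix S P → nextMove T′ r (suc c) ≡ left →
    Inner L r (suc c) → ∀ {a} → T′ r c ≡ just a → NE r c
  left-onto-path (pathEnd _) s e inn f = ⊥-elim (filled-and-empty f T′-x-empty)
  left-onto-path {suc r₃} {c} (pathUp e₃ _) s e inn f =
    let (l , Tl) = up⇒above-filled T r₃ c e₃
        i′ = proj₁ inn r₃ refl
        (u , Tu) = filled-below I r₃ (suc c) r₃ c i′ Tl ≤-refl (n≤1+n c)
        T′l : T′ (suc r₃) c ≡ just l
        T′l = trans (T′-incoming s (filled⇒≠h (suc r₃) c f)) Tl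
        T′u : T′ r₃ (suc c) ≡ just u
        T′u = trans (T′-off-path s r₃ (suc c) (≤-reflexive (+-suc r₃ c)) (inj₁ (n<1+n c)) (In⇒≠h r₃ (suc c) i′)) Tu
    in ⊥-elim (<⇒≱ (left⇒above<left T′ r₃ c e T′l T′u) (row-≤ I r₃ c l u Tl Tu))
  left-onto-path (pathLeft _ S) s e inn f = ne-on-left-step S s

  ne-up : ∀ {r c a} → NE (suc r) c → T′ r c ≡ just a → NE r c
  ne-up {r} {c} (ne-beyond lt₁ lt₂) f with rb + cb <? r + c
  ... | yes p = ne-beyond p (<-trans (n<1+n r) lt₂)
  ... | no ¬p = ne-beside P here (≤-antisym (s≤s⁻¹ lt₁) (≮⇒≥ ¬p)) (lower-below⇒left lt₁ lt₂)
  ne-up {r} {c} (ne-beside S s deq lt) f = next-beside S s deq lt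
    where
    next-beside : ∀ {r′ c′} (S : Path T r′ c′ x) → Suffix S P → r′ + c′ ≡ suc r + c → c′ < c → NE r c
    next-beside {r′} {c′} (pathEnd _) s deq lt =
      ne-end (≤-trans (n≤1+n r) (<⇒≤ (same-left⇒below deq lt))) (<⇒≤ lt)
             (Diff-lower (subst (r + c <_) (sym deq) (n<1+n _)))
    next-beside (pathUp _ S) s deq lt = ne-beside S (Suffix-trans (inUp here) s) (suc-injective deq) lt
    next-beside {r′} (pathLeft {c = c₂} _ S) s deq lt =
      ne-beside S (Suffix-trans (inLeft here) s) (suc-injective (trans (sym (+-suc r′ c₂)) deq)) (<-trans (n<1+n c₂) lt)
  ne-up {r} {suc c₀} (ne-on-left-step S s) f = ne-beside S (Suffix-trans (inLeft here) s) (sym (+-suc r c₀)) (n<1+n c₀)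
  ne-up {r} {c} (ne-end le₁ le₂ d) f = ne-end (≤-trans (n≤1+n r) le₁) le₂ (filled⇒≠x r c f)

  ne-left-beside : ∀ {r c a} (S : Path T (suc r) c x) → Suffix S P → nextMove T′ r (suc c) ≡ left →
    Inner L r (suc c) → T′ r c ≡ just a → NE r c
  ne-left-beside {r} (pathEnd _) s e inn f = ne-end (n≤1+n r) ≤-refl (λ { (p , _) → 1+n≢n (sym p) })
  ne-left-beside (pathUp _ S) s e inn f = left-onto-path S (Suffix-trans (inUp here) s) e inn f
  ne-left-beside {r} (pathLeft {c = c₂} _ S) s e inn f =
    ne-beside S (Suffix-trans (inLeft here) s) (sym (+-suc r c₂)) (n<1+n c₂)

  ne-left : ∀ {r c a} → Inner L r (suc c) → nextMove T′ r (suc c) ≡ left → NE r (suc c) → T′ r c ≡ just a → NE r c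
  ne-left {r} {c} inn e (ne-beyond lt₁ lt₂) f with rb + cb <? r + c
  ... | yes p = ne-beyond p lt₂
  ... | no ¬p = let eq = ≤-antisym (<+suc⇒≤ lt₁) (≮⇒≥ ¬p) in ne-beside P here eq (same-above⇒right (sym eq) lt₂)
  ne-left {r} {c} inn e (ne-beside S s deq lt) f with m≤n⇒m<n∨m≡n (s≤s⁻¹ lt)
  ... | inj₁ lt′ = next-beside S s deq lt′
    where
    next-beside : ∀ {r′ c′} (S : Path T r′ c′ x) → Suffix S P → r′ + c′ ≡ r + suc c → c′ < c → NE r c
    next-beside {r′} {c′} (pathEnd _) s deq lt′ =
      ne-end (<⇒≤ (same-left⇒below deq (≤-trans lt′ (n≤1+n c)))) (<⇒≤ lt′)
             (Diff-lower (subst (r + c <_) (sym (trans deq (+-suc r c))) (n<1+n _)))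
    next-beside (pathUp _ S) s deq lt′ = ne-beside S (Suffix-trans (inUp here) s) (suc-injective (trans deq (+-suc r c))) lt′
    next-beside {r′} (pathLeft {c = c₂} _ S) s deq lt′ =
      ne-beside S (Suffix-trans (inLeft here) s) (suc-injective (trans (sym (+-suc r′ c₂)) (trans deq (+-suc r c))))
                (<-trans (n<1+n c₂) lt′)
  ... | inj₂ refl = just-below S s (+-cancelʳ-≡ c _ (suc r) (trans deq (+-suc r c)))
    where
    just-below : ∀ {r′} (S : Path T r′ c x) → Suffix S P → r′ ≡ suc r → NE r c
    just-below S s refl = ne-left-beside S s e inn f
  ne-left inn e (ne-on-left-step S s) f = left-onto-path S (Suffix-trans (inLeft here) s) e inn f
  ne-left {r} {c} inn e (ne-end le₁ le₂ d) f with xc ≤? c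
  ... | yes p = ne-end le₁ p (filled⇒≠x r c f)
  ... | no ¬p =
    -- (r , c) would be left of x, hence empty in T and in T′
    let xc≡1+c = ≤-antisym le₂ (≰⇒> ¬p)
        r<xr = ≤∧≢⇒< le₁ (λ req → d (req , sym xc≡1+c))
        left-of-x = stop⇒left-empty T xr c (subst (λ z → nextMove T xr z ≡ stop) xc≡1+c (path-stop P))
        Trc = empty-closed I xr c r c (proj₂ x-inner c xc≡1+c) left-of-x (<⇒≤ r<xr) ≤-refl
    in ⊥-elim (filled-and-empty f
         (trans (T′-lower r c (+-mono-<-≤ r<xr (≤-trans (n≤1+n c) (≤-reflexive (sym xc≡1+c))))) Trc))

  -- When Q stops, NE says it stopped above-right of x: in the other cases a
  -- filled box of T′ would lie directly above or left of the stop.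
  ne-stop : ∀ {r c} → Inner L r c → NE r c → nextMove T′ r c ≡ stop → AboveRightOfEnd (r , c)
  ne-stop inn (ne-end le₁ le₂ d) e = (le₂ , le₁) , d
  ne-stop {r} {c} inn (ne-beyond lt₁ lt₂) e with r ≤? xr
  ... | yes le = (≤-trans (proj₂ (path-le P)) (<⇒≤ (lower-below⇒left lt₁ lt₂)) , le) ,
                 Diff-higher (≤-<-trans (path-antidiag P) lt₁)
  ... | no ¬le with r | ≰⇒> ¬le
  ...   | suc r₁ | xr≤r₁ =
    let (c₀ , _ , c₀≤ , p) = path-crosses-row P r₁ (s≤s⁻¹ xr≤r₁) (<-trans (n<1+n r₁) lt₂)
        cb<c = lower-below⇒left lt₁ lt₂
        (_ , Tb) = filled-below I r₁ c r₁ c₀ (proj₁ inn r₁ refl) p ≤-refl (≤-trans c₀≤ (<⇒≤ cb<c))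
    in ⊥-elim (filled-and-empty (trans (T′-right-of-h r₁ c (s≤s⁻¹ lt₁) cb<c) Tb) (stop⇒above-empty T′ r₁ c e))
  ne-stop {r} {c} inn (ne-beside {r′ = r′} {c′} S s deq lt) e with r ≤? xr
  ... | yes le = let right = ≤-<-trans (proj₂ (path-le S)) lt in (<⇒≤ right , le) , λ { (refl , refl) → <-irrefl refl right }
  ... | no ¬le with r | ≰⇒> ¬le | deq
  ...   | suc r₁ | xr≤r₁ | deq =
    let (c₀ , _ , c₀≤ , p) = path-crosses-row S r₁ (s≤s⁻¹ xr≤r₁) (<-trans (n<1+n r₁) (same-left⇒below deq lt))
        (_ , Tb) = filled-below I r₁ c r₁ c₀ (proj₁ inn r₁ refl) p ≤-refl (≤-trans c₀≤ (<⇒≤ lt))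
        lower : r₁ + c < r′ + c′
        lower = subst (r₁ + c <_) (sym deq) (n<1+n _)
        T′b = trans (T′-off-path s r₁ c (<⇒≤ lower) (inj₁ lt) (Diff-lower (<-≤-trans lower (Suffix-antidiag s)))) Tb
    in ⊥-elim (filled-and-empty T′b (stop⇒above-empty T′ r₁ c e))
  ne-stop {r} {suc c₀} inn (ne-on-left-step S s) e =
    at-end S s (trans (sym (T′-incoming (Suffix-trans (inLeft here) s)
                                        (Diff-lower (<-≤-trans (r+c<r+1+c r c₀) (Suffix-antidiag s)))))
                      (stop⇒left-empty T′ r c₀ e))
    where
    at-end : (S : Path T r c₀ x) → Suffix (pathLeft _ S) P → incoming S ≡ nothing → AboveRightOfEnd (r , suc c₀)
    at-end (pathEnd _) _ _ = (n≤1+n c₀ , ≤-refl) , λ { (_ , q) → 1+n≢n q }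
    at-end (pathUp {r₃} e₃ _) _ v = ⊥-elim (filled-and-empty (proj₂ (up⇒above-filled T r₃ c₀ e₃)) v)
    at-end (pathLeft {c = c₃} e₃ _) _ v = ⊥-elim (filled-and-empty (proj₂ (left⇒left-filled T r c₃ e₃)) v)

  ne-path : ∀ {r c x′} → Inner L r c → NE r c → Path T′ r c x′ → AboveRightOfEnd x′
  ne-path inn g (pathEnd e) = ne-stop inn g e
  ne-path inn g (pathUp {r} {c} e Q) =
    let (_ , f) = up⇒above-filled T′ r c e in ne-path (filled⇒Inner r c f) (ne-up g f) Q
  ne-path inn g (pathLeft {r} {c} e Q) =
    let (_ , f) = left⇒left-filled T′ r c e in ne-path (filled⇒Inner r c f) (ne-left inn e g f) Q

  BelowLeftOfEnd : Box → Set
  BelowLeftOfEnd x′ = ((col x′ ≤ xc) × (xr ≤ row x′)) × Diff xr xc (row x′) (col x′)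

  data SW : ℕ → ℕ → Set where
    sw-beyond     : ∀ {r c} → rb + cb < r + c → c < cb → SW r c
    sw-beside     : ∀ {r c r′ c′} (S : Path T r′ c′ x) → Suffix S P → r′ + c′ ≡ r + c → r′ < r → SW r c
    sw-on-up-step : ∀ {r c} {e} (S : Path T r c x) → Suffix (pathUp e S) P → SW (suc r) c
    sw-end        : ∀ {r c} → c ≤ xc → xr ≤ r → Diff xr xc r c → SW r c

  sw-start : ∀ rj cj → rb < rj → cj < cb → SW rj cj
  sw-start rj cj lt₁ lt₂ with rb + cb <? rj + cj
  ... | yes p = sw-beyond p lt₂
  ... | no ¬p with xr + xc ≤? rj + cj
  ...   | yes q = let (_ , _ , S , s , eq) = Suffix-exists P (rj + cj) q (≮⇒≥ ¬p)
                  in sw-beside S s eq (≤-<-trans (proj₁ (Suffix-le s)) lt₁)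
  ...   | no ¬q = let lower = ≰⇒> ¬q
                      below = ≤-<-trans (proj₁ (path-le P)) lt₁
                  in sw-end (<⇒≤ (lower-below⇒left lower below)) (<⇒≤ below) (Diff-lower lower)

  up-onto-path : ∀ {r c} (S : Path T r c x) → Suffix S P → nextMove T′ (suc r) c ≡ up →
    Inner L (suc r) c → ∀ {a} → T′ r c ≡ just a → SW r c
  up-onto-path (pathEnd _) s e inn f = ⊥-elim (filled-and-empty f T′-x-empty)
  up-onto-path {r} {suc c₃} (pathLeft e₃ _) s e inn f =
    let (l , Tl) = left⇒left-filled T r c₃ e₃
        i′ = proj₂ inn c₃ refl
        (u , Tu) = filled-below I (suc r) c₃ r c₃ i′ Tl (n≤1+n r) ≤-refl
        T′l : T′ r (suc c₃) ≡ just l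
        T′l = trans (T′-incoming s (filled⇒≠h r (suc c₃) f)) Tl
        T′u : T′ (suc r) c₃ ≡ just u
        T′u = trans (T′-off-path s (suc r) c₃ (≤-reflexive (sym (+-suc r c₃))) (inj₂ (n<1+n r)) (In⇒≠h (suc r) c₃ i′)) Tu
    in ⊥-elim (<⇒≱ (col-< I r c₃ l u Tl Tu) (up⇒left≤above T′ r c₃ e T′u T′l))
  up-onto-path (pathUp _ S) s e inn f = sw-on-up-step S s

  sw-left : ∀ {r c a} → SW r (suc c) → T′ r c ≡ just a → SW r c
  sw-left {r} {c} (sw-beyond lt₁ lt₂) f with rb + cb <? r + c
  ... | yes p = sw-beyond p (<-trans (n<1+n c) lt₂)
  ... | no ¬p = sw-beside P here (≤-antisym (<+suc⇒≤ lt₁) (≮⇒≥ ¬p)) (lower-right⇒above lt₁ lt₂)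
  sw-left {r} {c} (sw-beside S s deq lt) f = next-beside S s deq lt
    where
    next-beside : ∀ {r′ c′} (S : Path T r′ c′ x) → Suffix S P → r′ + c′ ≡ r + suc c → r′ < r → SW r c
    next-beside {r′} {c′} (pathEnd _) s deq lt =
      sw-end (≤-trans (n≤1+n c) (<⇒≤ (same-above⇒right deq lt))) (<⇒≤ lt)
             (Diff-lower (subst (r + c <_) (sym (trans deq (+-suc r c))) (n<1+n _)))
    next-beside (pathUp {r₂} _ S) s deq lt =
      sw-beside S (Suffix-trans (inUp here) s) (suc-injective (trans deq (+-suc r c))) (<-trans (n<1+n r₂) lt)
    next-beside {r′} (pathLeft {c = c₂} _ S) s deq lt =
      sw-beside S (Suffix-trans (inLeft here) s) (suc-injective (trans (sym (+-suc r′ c₂)) (trans deq (+-suc r c)))) lt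
  sw-left {suc r₀} {c} (sw-on-up-step S s) f = sw-beside S (Suffix-trans (inUp here) s) (+-suc r₀ c) (n<1+n r₀)
  sw-left {r} {c} (sw-end le₁ le₂ d) f = sw-end (≤-trans (n≤1+n c) le₁) le₂ (filled⇒≠x r c f)

  sw-up-beside : ∀ {r c a} (S : Path T r (suc c) x) → Suffix S P → nextMove T′ (suc r) c ≡ up →
    Inner L (suc r) c → T′ r c ≡ just a → SW r c
  sw-up-beside {r} {c} (pathEnd _) s e inn f = sw-end (n≤1+n c) ≤-refl (λ { (_ , q) → 1+n≢n (sym q) })
  sw-up-beside (pathLeft _ S) s e inn f = up-onto-path S (Suffix-trans (inLeft here) s) e inn f
  sw-up-beside {suc r₂} {c} (pathUp _ S) s e inn f = sw-beside S (Suffix-trans (inUp here) s) (+-suc r₂ c) (n<1+n r₂)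

  sw-up : ∀ {r c a} → Inner L (suc r) c → nextMove T′ (suc r) c ≡ up → SW (suc r) c → T′ r c ≡ just a → SW r c
  sw-up {r} {c} inn e (sw-beyond lt₁ lt₂) f with rb + cb <? r + c
  ... | yes p = sw-beyond p lt₂
  ... | no ¬p = let eq = ≤-antisym (s≤s⁻¹ lt₁) (≮⇒≥ ¬p) in sw-beside P here eq (same-left⇒below (sym eq) lt₂)
  sw-up {r} {c} inn e (sw-beside S s deq lt) f with m≤n⇒m<n∨m≡n (s≤s⁻¹ lt)
  ... | inj₁ lt′ = next-beside S s deq lt′
    where
    next-beside : ∀ {r′ c′} (S : Path T r′ c′ x) → Suffix S P → r′ + c′ ≡ suc r + c → r′ < r → SW r c
    next-beside {r′} {c′} (pathEnd _) s deq lt′ =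
      sw-end (<⇒≤ (same-above⇒right deq (≤-trans lt′ (n≤1+n r)))) (<⇒≤ lt′)
             (Diff-lower (subst (r + c <_) (sym deq) (n<1+n _)))
    next-beside (pathUp {r₂} _ S) s deq lt′ =
      sw-beside S (Suffix-trans (inUp here) s) (suc-injective deq) (<-trans (n<1+n r₂) lt′)
    next-beside {r′} (pathLeft {c = c₂} _ S) s deq lt′ =
      sw-beside S (Suffix-trans (inLeft here) s) (suc-injective (trans (sym (+-suc r′ c₂)) deq)) lt′
  ... | inj₂ refl = just-right S s (+-cancelˡ-≡ r _ (suc c) (trans deq (sym (+-suc r c))))
    where
    just-right : ∀ {c′} (S : Path T r c′ x) → Suffix S P → c′ ≡ suc c → SW r c
    just-right S s refl = sw-up-beside S s e inn f
  sw-up inn e (sw-on-up-step S s) f = up-onto-path S (Suffix-trans (inUp here) s) e inn f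
  sw-up {r} {c} inn e (sw-end le₁ le₂ d) f with xr ≤? r
  ... | yes p = sw-end le₁ p (filled⇒≠x r c f)
  ... | no ¬p =
    -- (r , c) would be above x, hence empty in T and in T′
    let xr≡1+r = ≤-antisym le₂ (≰⇒> ¬p)
        c<xc = ≤∧≢⇒< le₁ (λ ceq → d (sym xr≡1+r , ceq))
        above-x = stop⇒above-empty T r xc (subst (λ z → nextMove T z xc ≡ stop) xr≡1+r (path-stop P))
        Trc = empty-closed I r xc r c (proj₁ x-inner r xr≡1+r) above-x ≤-refl (<⇒≤ c<xc)
    in ⊥-elim (filled-and-empty f
         (trans (T′-lower r c (+-mono-≤-< (≤-trans (n≤1+n r) (≤-reflexive (sym xr≡1+r))) c<xc)) Trc))

  sw-stop : ∀ {r c} → Inner L r c → SW r c → nextMove T′ r c ≡ stop → BelowLeftOfEnd (r , c)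
  sw-stop inn (sw-end le₁ le₂ d) e = (le₁ , le₂) , d
  sw-stop {r} {c} inn (sw-beyond lt₁ lt₂) e with c ≤? xc
  ... | yes le = (le , ≤-trans (proj₁ (path-le P)) (<⇒≤ (lower-right⇒above lt₁ lt₂))) ,
                 Diff-higher (≤-<-trans (path-antidiag P) lt₁)
  ... | no ¬le with c | ≰⇒> ¬le
  ...   | suc c₁ | xc≤c₁ =
    let (r₀ , _ , r₀≤ , p) = path-crosses-col P c₁ (s≤s⁻¹ xc≤c₁) (<-trans (n<1+n c₁) lt₂)
        rb<r = lower-right⇒above lt₁ lt₂
        (_ , Tb) = filled-below I r c₁ r₀ c₁ (proj₂ inn c₁ refl) p (≤-trans r₀≤ (<⇒≤ rb<r)) ≤-refl
    in ⊥-elim (filled-and-empty (trans (T′-below-h r c₁ (<+suc⇒≤ lt₁) rb<r) Tb) (stop⇒left-empty T′ r c₁ e))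
  sw-stop {r} {c} inn (sw-beside {r′ = r′} {c′} S s deq lt) e with c ≤? xc
  ... | yes le = let below = ≤-<-trans (proj₁ (path-le S)) lt in (le , <⇒≤ below) , λ { (refl , refl) → <-irrefl refl below }
  ... | no ¬le with c | ≰⇒> ¬le | deq
  ...   | suc c₁ | xc≤c₁ | deq =
    let (r₀ , _ , r₀≤ , p) = path-crosses-col S c₁ (s≤s⁻¹ xc≤c₁) (<-trans (n<1+n c₁) (same-above⇒right deq lt))
        (_ , Tb) = filled-below I r c₁ r₀ c₁ (proj₂ inn c₁ refl) p (≤-trans r₀≤ (<⇒≤ lt)) ≤-refl
        lower : r + c₁ < r′ + c′
        lower = subst (r + c₁ <_) (sym (trans deq (+-suc r c₁))) (n<1+n _)
        T′b = trans (T′-off-path s r c₁ (<⇒≤ lower) (inj₂ lt) (Diff-lower (<-≤-trans lower (Suffix-antidiag s)))) Tb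
    in ⊥-elim (filled-and-empty T′b (stop⇒left-empty T′ r c₁ e))
  sw-stop {suc r₀} {c} inn (sw-on-up-step S s) e =
    at-end S s (trans (sym (T′-incoming (Suffix-trans (inUp here) s)
                                        (Diff-lower (<-≤-trans (n<1+n _) (Suffix-antidiag s)))))
                      (stop⇒above-empty T′ r₀ c e))
    where
    at-end : (S : Path T r₀ c x) → Suffix (pathUp _ S) P → incoming S ≡ nothing → BelowLeftOfEnd (suc r₀ , c)
    at-end (pathEnd _) _ _ = (≤-refl , n≤1+n r₀) , λ { (q , _) → 1+n≢n q }
    at-end (pathUp {r₃} e₃ _) _ v = ⊥-elim (filled-and-empty (proj₂ (up⇒above-filled T r₃ c e₃)) v)
    at-end (pathLeft {c = c₃} e₃ _) _ v = ⊥-elim (filled-and-empty (proj₂ (left⇒left-filled T r₀ c₃ e₃)) v)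

  sw-path : ∀ {r c x′} → Inner L r c → SW r c → Path T′ r c x′ → BelowLeftOfEnd x′
  sw-path inn g (pathEnd e) = sw-stop inn g e
  sw-path inn g (pathUp {r} {c} e Q) =
    let (_ , f) = up⇒above-filled T′ r c e in sw-path (filled⇒Inner r c f) (sw-up inn e g f) Q
  sw-path inn g (pathLeft {r} {c} e Q) =
    let (_ , f) = left⇒left-filled T′ r c e in sw-path (filled⇒Inner r c f) (sw-left g f) Q

  ends-above-right : ∀ {r c x′} → Inner L r c → r < rb → cb < c → Path T′ r c x′ → x <ᵇ x′
  ends-above-right inn lt₁ lt₂ Q with ne-path inn (ne-start _ _ lt₁ lt₂) Q
  ... | le , d = le , λ e → d (cong row (sym e) , cong col (sym e))

  ends-below-left : ∀ {r c x′} → Inner L r c → rb < r → c < cb → Path T′ r c x′ → x′ <ᵇ x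
  ends-below-left inn lt₁ lt₂ Q with sw-path inn (sw-start _ _ lt₁ lt₂) Q
  ... | le , d = le , λ e → d (cong row e , cong col e)

-- Diagonals

module Diagonal {n : ℕ} (λ₊ λ₋ : YoungDiagram) (b : Fin n → Box) (D : IsDiagonal n λ₊ λ₋ b) where

  skew⇔b : ∀ x → ((x ∈ʸ λ₊) × ¬ (x ∈ʸ λ₋)) ⇔ (∃[ i ] b i ≡ x)
  skew⇔b = proj₁ (proj₂ D)

  b-step : ∀ (i j : Fin n) → toℕ j ≡ suc (toℕ i) → (row (b j) < row (b i)) × (col (b i) < col (b j))
  b-step = proj₂ (proj₂ D)

  b∉λ₋ : ∀ i → ¬ In λ₋ (row (b i)) (col (b i))
  b∉λ₋ i = proj₂ (Equivalence.from (skew⇔b (b i)) (i , refl))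

  b∈λ₊ : ∀ i → In λ₊ (row (b i)) (col (b i))
  b∈λ₊ i = proj₁ (Equivalence.from (skew⇔b (b i)) (i , refl))

  b-ordered-gap : ∀ (i : Fin n) d (j : Fin n) → toℕ j ≡ suc (d + toℕ i) →
    (row (b j) < row (b i)) × (col (b i) < col (b j))
  b-ordered-gap i zero j e = b-step i j e
  b-ordered-gap i (suc d) j e =
    let k<n : suc (d + toℕ i) < n
        k<n = <-trans (subst (suc (d + toℕ i) <_) (sym e) (n<1+n _)) (toℕ<n j)
        k = fromℕ< k<n
        (row-ik , col-ik) = b-ordered-gap i d k (toℕ-fromℕ< k<n)
        (row-kj , col-kj) = b-step k j (trans e (cong suc (sym (toℕ-fromℕ< k<n))))
    in <-trans row-kj row-ik , <-trans col-ik col-kj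

  b-ordered : ∀ (i j : Fin n) → toℕ i < toℕ j → (row (b j) < row (b i)) × (col (b i) < col (b j))
  b-ordered i j lt with m≤n⇒∃[o]m+o≡n lt
  ... | d , e = b-ordered-gap i d j (trans (sym e) (cong suc (+-comm (toℕ i) d)))

  col-injective : ∀ i j → col (b i) ≡ col (b j) → i ≡ j
  col-injective i j e with <-cmp (toℕ i) (toℕ j)
  ... | tri< lt _ _ = ⊥-elim (<-irrefl e (proj₂ (b-ordered i j lt)))
  ... | tri≈ _ eq _ = toℕ-injective eq
  ... | tri> _ _ gt = ⊥-elim (<-irrefl (sym e) (proj₂ (b-ordered j i gt)))

  row-injective : ∀ i j → row (b i) ≡ row (b j) → i ≡ j
  row-injective i j e with <-cmp (toℕ i) (toℕ j)
  ... | tri< lt _ _ = ⊥-elim (<-irrefl (sym e) (proj₁ (b-ordered i j lt)))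
  ... | tri≈ _ eq _ = toℕ-injective eq
  ... | tri> _ _ gt = ⊥-elim (<-irrefl e (proj₁ (b-ordered j i gt)))

  -- The neighbours above and to the left of a diagonal box lie in λ₋:
  -- otherwise they would be diagonal boxes in the same column (resp. row).
  b-inner : ∀ i → Inner λ₋ (row (b i)) (col (b i))
  b-inner i = above , leftOf
    where
    above : ∀ r′ → row (b i) ≡ suc r′ → In λ₋ r′ (col (b i))
    above r′ e with col (b i) <? rowLen λ₋ r′
    ... | yes i∈ = i∈
    ... | no i∉ =
      let inλ₊ = In-down λ₊ (b∈λ₊ i) (≤-trans (n≤1+n r′) (≤-reflexive (sym e))) ≤-refl
          (k , ek) = Equivalence.to (skew⇔b (r′ , col (b i))) (inλ₊ , i∉)
          k≡i = col-injective k i (cong col ek)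
      in ⊥-elim (1+n≢n (trans (sym e) (trans (cong (λ z → row (b z)) (sym k≡i)) (cong row ek))))
    leftOf : ∀ c′ → col (b i) ≡ suc c′ → In λ₋ (row (b i)) c′
    leftOf c′ e with c′ <? rowLen λ₋ (row (b i))
    ... | yes i∈ = i∈
    ... | no i∉ =
      let inλ₊ = In-down λ₊ (b∈λ₊ i) ≤-refl (≤-trans (n≤1+n c′) (≤-reflexive (sym e)))
          (k , ek) = Equivalence.to (skew⇔b (row (b i) , c′)) (inλ₊ , i∉)
          k≡i = row-injective k i (cong row ek)
      in ⊥-elim (1+n≢n (trans (sym e) (trans (cong (λ z → col (b z)) (sym k≡i)) (cong col ek))))

module BoxSequence {n : ℕ} (λ₊ λ₋ : YoungDiagram) (b : Fin n → Box) (D : IsDiagonal n λ₊ λ₋ b)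
                   (σ : ℕ → Fin n) (U : Filling) (syt : IsSYT λ₋ U) where

  open Diagonal λ₊ λ₋ b D public

  Uₖ : ℕ → Filling
  Uₖ = states b σ U

  rₖ cₖ : ℕ → ℕ
  rₖ k = row (b (σ k))
  cₖ k = col (b (σ k))

  slide : ∀ k → SlideOutcome (revSlide (rₖ k) (cₖ k) (Uₖ k)) (Uₖ k) (rₖ k) (cₖ k) (Uₖ k)
  slide k = revSlide-outcome (b (σ k)) (Uₖ k)

  xₖ : ℕ → Box
  xₖ k = proj₁ (slide k)

  path : ∀ k → Path (Uₖ k) (rₖ k) (cₖ k) (xₖ k)
  path k = proj₁ (proj₂ (slide k))

  boxSeq≡xₖ : ∀ k → boxSeq b σ U k ≡ xₖ k
  boxSeq≡xₖ k = proj₁ (proj₂ (proj₂ (slide k)))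

  Uₖ₊₁≐Next : ∀ k → Uₖ (suc k) ≐ set (rₖ k) (cₖ k) nothing (slideAlong (path k) (Uₖ k))
  Uₖ₊₁≐Next k = set-cong (rₖ k) (cₖ k) nothing (proj₂ (proj₂ (proj₂ (slide k))))

  Uₖ-Inv : ∀ k → Inv λ₋ (Uₖ k)
  Uₖ-Inv zero = SYT⇒Inv λ₋ U syt
  Uₖ-Inv (suc k) =
    Inv-≐ (SlideStep.Next-Inv λ₋ (Uₖ k) (Uₖ-Inv k) (rₖ k) (cₖ k) (b∉λ₋ (σ k)) (b-inner (σ k)) (path k))
          (≐-sym (Uₖ₊₁≐Next k))

  module Step (k : ℕ) = Consecutive λ₋ (Uₖ k) (Uₖ-Inv k) (rₖ k) (cₖ k) (b∉λ₋ (σ k)) (b-inner (σ k))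
                                    (path k) (Uₖ (suc k)) (Uₖ₊₁≐Next k)

proposition2p2 : (m n : ℕ) → n ≤ m → 1 ≤ n →
    (a c : ℕ) → ((a ≡ n) × (c ≡ m)) ⊎ ((a ≡ m) × (c ≡ n)) →
    (λ₊ λ₋ : YoungDiagram) → InRect a c λ₊ → InRect a c λ₋ →
    (b : Fin n → Box) → IsDiagonal n λ₊ λ₋ b →
    (σ : ℕ → Fin n) → (U : Filling) → IsSYT λ₋ U →
    (k : ℕ) →
    ((σ k <ᶠ σ (suc k)) → (boxSeq b σ U k <ᵇ boxSeq b σ U (suc k)))
    × ((σ k >ᶠ σ (suc k)) → (boxSeq b σ U (suc k) <ᵇ boxSeq b σ U k))
proposition2p2 _ _ _ _ _ _ _ λ₊ λ₋ _ _ b D σ U syt k = increasing , decreasing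
  where
  open BoxSequence λ₊ λ₋ b D σ U syt

  increasing : σ k <ᶠ σ (suc k) → boxSeq b σ U k <ᵇ boxSeq b σ U (suc k)
  increasing lt =
    let (above , right) = b-ordered (σ k) (σ (suc k)) lt
    in subst₂ _<ᵇ_ (sym (boxSeq≡xₖ k)) (sym (boxSeq≡xₖ (suc k)))
              (Step.ends-above-right k (b-inner (σ (suc k))) above right (path (suc k)))

  decreasing : σ k >ᶠ σ (suc k) → boxSeq b σ U (suc k) <ᵇ boxSeq b σ U k
  decreasing lt =
    let (below , leftOf) = b-ordered (σ (suc k)) (σ k) lt
    in subst₂ _<ᵇ_ (sym (boxSeq≡xₖ (suc k))) (sym (boxSeq≡xₖ k))
              (Step.ends-below-left k (b-inner (σ (suc k))) below leftOf (path (suc k)))
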